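{- Let $\Sigma$ be a set of formulae closed under subformulae, let $\mathfrak{J}=\langle W,\mathcal{A},\{R_X:X\in\mathcal{A}\},\nu\rangle$ be a Kripke $\mathbf{LCR}$ model, and let $\mathfrak{J}^*$ be a filtration of $\mathfrak{J}$ through $\Sigma$. Then for every $\phi\in\Sigma$, every $x\in W$ and every $a\in\mathcal{T}$: $\nu_x(\phi)=a$ if and only if $\nu^*_{[x]}(\phi)=a$. That is, $[|\phi|]=|\phi|^*$ for every $\phi\in\Sigma$.
   Context: Fix an integer $m\ge 2$ and let $\mathcal{T}=\{0,\frac{1}{m-1},\dots,\frac{m-2}{m-1},1\}$ with its natural order. For $a,b\in\mathcal{T}$ put $\sim a=1-a$, $a\rightarrow b=\min\{1,1-a+b\}$. The language $\mathcal{L}_{\succ}$ has a countable set $\Pi$ of propositional variables, the unary connective $\neg$ and the binary connectives $\rightarrow$ and $\succ$. A Kripke $\mathbf{LCR}$ model is $\mathfrak{J}=\langle W,\mathcal{A},\{R_X:X\in\mathcal{A}\},\nu\rangle$ with $W$ a nonempty set, $\mathcal{A}\subseteq(\mathcal{P}(W))^m$, each $R_X:W\times W\to\mathcal{T}$ (write $xR_Xy$), and $\nu:\Pi\times W\to\mathcal{T}$ (write $\nu_x(p)$), extended to all formulae by $\nu_x(\neg\phi)=\sim\nu_x(\phi)$, $\nu_x(\phi\rightarrow\psi)=\nu_x(\phi)\rightarrow\nu_x(\psi)$, $\nu_x(\phi\succ\psi)=\bigwedge\{xR_{|\phi|}y\rightarrow\nu_y(\psi):y\in W\}$, where $|\phi|=(|\phi|_1,\dots,|\phi|_m)$,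 $|\phi|_i=\{x\in W:\nu_x(\phi)=\frac{i-1}{m-1}\}$ (the semantics presupposes $|\phi|\in\mathcal{A}$). Filtration: for $\Sigma$ closed under subformulae, define $x\equiv y$ iff for every $\phi\in\Sigma$ and $a\in\mathcal{T}$, $\nu_x(\phi)=a$ iff $\nu_y(\phi)=a$; let $[x]$ be the $\equiv$-class of $x$ and $[W]$ the set of classes. For $X=(X_1,\dots,X_m)\in\mathcal{A}$ put $[X]=([X]_1,\dots,[X]_m)$ with $[X]_i=\{[x]:x\in X_i\}\subseteq[W]$, and $[\mathcal{A}]=\{[X]:X\in\mathcal{A}\}$. A filtration of $\mathfrak{J}$ through $\Sigma$ is any model $\mathfrak{J}^*=\langle W^*,\mathcal{A}^*,\{R^*_{X^*}:X^*\in\mathcal{A}^*\},\nu^*\rangle$ with $W^*=[W]$, $\mathcal{A}^*=[\mathcal{A}]$, $\nu^*:\Pi\times W^*\to\mathcal{T}$ and each $R^*_{X^*}:W^*\times W^*\to\mathcal{T}$, such that (a) $\nu^*_{[y]}(p)=\nu_y(p)$ whenever $p\in\Sigma$; (b) $[x]R^*_{[X]}[y]=\bigvee\{x'R_Xy':x'\in[x],\ y'\in[y]\}$ (supremum). $|\phi|^*$ denotes the proposition expressed by $\phi$ in $\mathfrak{J}^*$, and $[|\phi|]$ is $[X]$ for $X=|\phi|$. -}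

module Defs where

open import Data.Nat using (ℕ; zero; suc; _∸_; s≤s)
open import Data.Nat.Properties using (m∸n≤m)
open import Data.Fin using (Fin; toℕ; fromℕ<; opposite; _≤_)
open import Data.Product using (Σ; ∃; _×_; _,_)
open import Function.Bundles using (_⇔_)
open import Relation.Binary.PropositionalEquality using (_≡_)

-- Truth values: with m = suc n (so n = m - 1), the index i : Fin (suc n)
-- stands for the truth value i/n ∈ 𝒯.  The natural order is Fin's _≤_.
𝒯 : ℕ → Set
𝒯 n = Fin (suc n)

-- ∼ a = 1 - a   (index i ↦ n - i)
∼_ : ∀ {n} → 𝒯 n → 𝒯 n
∼ a = opposite a

-- a → b = min{1, 1 - a + b}   (indices: n ∸ (i ∸ j) = min(n, n - i + j))
_⇒ₜ_ : ∀ {n} → 𝒯 n → 𝒯 n → 𝒯 n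
_⇒ₜ_ {n} a b = fromℕ< {n ∸ (toℕ a ∸ toℕ b)} (s≤s (m∸n≤m n (toℕ a ∸ toℕ b)))

IsInf : ∀ {n} {I : Set} → (I → 𝒯 n) → 𝒯 n → Set
IsInf {n} {I} f a = (∀ i → a ≤ f i) × (∀ (b : 𝒯 n) → (∀ i → b ≤ f i) → b ≤ a)

IsSup : ∀ {n} {I : Set} → (I → 𝒯 n) → 𝒯 n → Set
IsSup {n} {I} f a = (∀ i → f i ≤ a) × (∀ (b : 𝒯 n) → (∀ i → f i ≤ b) → a ≤ b)

data Fm : Set where
  var  : ℕ → Fm
  ¬'_  : Fm → Fm
  _⟶_  : Fm → Fm → Fm
  _≻_  : Fm → Fm → Fm

data ImmSub : Fm → Fm → Set where
  sub-¬  : ∀ φ → ImmSub φ (¬' φ)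
  sub-⟶ˡ : ∀ φ ψ → ImmSub φ (φ ⟶ ψ)
  sub-⟶ʳ : ∀ φ ψ → ImmSub ψ (φ ⟶ ψ)
  sub-≻ˡ : ∀ φ ψ → ImmSub φ (φ ≻ ψ)
  sub-≻ʳ : ∀ φ ψ → ImmSub ψ (φ ≻ ψ)

SubClosed : (Fm → Set) → Set
SubClosed S = ∀ {φ ψ} → ImmSub φ ψ → S ψ → S φ

-- m-tuples of subsets of W  (elements of (𝒫(W))^m)
Tuple : ℕ → Set → Set₁
Tuple n W = 𝒯 n → W → Set

_≐_ : ∀ {n W} → Tuple n W → Tuple n W → Set
X ≐ Y = ∀ i w → X i w ⇔ Y i w

-- The data of a Kripke LCR model (m = suc n).  R is given on all tuples;
-- only its values on tuples in 𝒜 are meaningful.  Sets are extensional.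
record Structure (n : ℕ) : Set₁ where
  field
    W        : Set
    nonempty : W
    𝒜        : Tuple n W → Set
    R        : Tuple n W → W → W → 𝒯 n
    ν        : ℕ → W → 𝒯 n
    𝒜-ext    : ∀ {X Y} → X ≐ Y → 𝒜 X → 𝒜 Y
    R-ext    : ∀ {X Y} → X ≐ Y → ∀ x y → R X x y ≡ R Y x y

prop : ∀ {n} {W : Set} → (W → Fm → 𝒯 n) → Fm → Tuple n W
prop V φ i x = V x φ ≡ i

-- V is the extension of ν to all formulae (the semantic clauses),
-- including the presupposition |φ| ∈ 𝒜.
record IsExtension {n} (S : Structure n) (V : Structure.W S → Fm → 𝒯 n) : Set₁ where
  open Structure S
  field
    V-var  : ∀ x p → V x (var p) ≡ ν p x
    V-¬    : ∀ x φ → V x (¬' φ) ≡ ∼ V x φ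
    V-⟶    : ∀ x φ ψ → V x (φ ⟶ ψ) ≡ (V x φ ⇒ₜ V x ψ)
    V-≻    : ∀ x φ ψ → IsInf (λ (y : W) → R (prop V φ) x y ⇒ₜ V y ψ) (V x (φ ≻ ψ))
    presup : ∀ φ → 𝒜 (prop V φ)

record Model (n : ℕ) : Set₁ where
  field
    structure : Structure n
  open Structure structure public
  field
    V     : W → Fm → 𝒯 n
    isExt : IsExtension structure V

Equiv : ∀ {n} (J : Model n) (S : Fm → Set) → Model.W J → Model.W J → Set
Equiv J S x y = ∀ φ → S φ → ∀ a → (Model.V J x φ ≡ a ⇔ Model.V J y φ ≡ a)

-- A filtration of J through S.  [W] is represented by W* together with the
-- quotient map q : W → W*, x ↦ [x] (surjective, q x ≡ q y ⇔ x ≡_Σ y).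
record Filtration {n} (J : Model n) (S : Fm → Set) : Set₁ where
  module J = Model J
  field
    J*   : Model n
  module J* = Model J*
  field
    q      : J.W → J*.W
    q-surj : ∀ w → ∃ λ x → q x ≡ w
    q-eq   : ∀ x y → (q x ≡ q y ⇔ Equiv J S x y)
  img : Tuple n J.W → Tuple n J*.W
  img X i w = ∃ λ x → q x ≡ w × X i x
  field
    𝒜*-def : ∀ X* → (J*.𝒜 X* ⇔ (∃ λ X → J.𝒜 X × X* ≐ img X))
    cond-a : ∀ p → S (var p) → ∀ y → J*.ν p (q y) ≡ J.ν p y
    cond-b : ∀ X → J.𝒜 X → ∀ x y →
             IsSup (λ (p : (∃ λ x' → q x' ≡ q x) × (∃ λ y' → q y' ≡ q y)) →
                      J.R X (Data.Product.proj₁ (Data.Product.proj₁ p))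
                            (Data.Product.proj₁ (Data.Product.proj₂ p)))
                   (J*.R (img X) (q x) (q y))

module Submission where

-- The only non-trivial case is φ ≻ ψ.  Łukasiewicz implication is antitone and
-- residuated in its first argument (a ≤ r ⇒ c iff r ≤ a ⇒ c), so r ↦ r ⇒ c turns
-- the supremum defining [x] R*_[|φ|] [y] into an infimum over representatives
-- x′ ∈ [x], y′ ∈ [y].  Since φ ≻ ψ, ψ ∈ Σ, the values ν_x′(φ ≻ ψ) and ν_y′(ψ) do not
-- depend on the representatives, and both infima defining ν_x(φ ≻ ψ) and
-- ν*_[x](φ ≻ ψ) collapse to the same value.

open import Defs
open import Data.Nat using (ℕ; _≤_)
open import Data.Product using (_×_)
open import Function.Bundles using (_⇔_)
open import Relation.Binary.PropositionalEquality using (_≡_)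

open import Algebra.Properties.CommutativeSemigroup using (x∙yz≈y∙xz)
open import Data.Fin using (toℕ) renaming (_≤_ to _≤ₜ_)
import Data.Fin.Properties as Fin
open import Data.Nat using (_+_; _∸_)
open import Data.Nat.Properties
  using (+-commutativeSemigroup; ≤-total; ≤-trans; +-comm; +-identityʳ; +-∸-assoc; +-monoʳ-≤;
         m≤n⇒m∸n≡0; m≤n+m∸n; m≤n+o⇒m∸n≤o; m+n≤o⇒m≤o∸n; m≤o∸n⇒m+n≤o; m∸n≤m; ∸-monoʳ-≤; ∸-monoˡ-≤;
         module ≤-Reasoning)
open import Data.Product using (∃; _,_; proj₁; proj₂)
open import Data.Sum using (_⊎_; inj₁; inj₂)
open import Function.Bundles using (mk⇔; module Equivalence)
open import Function.Construct.Symmetry using (⇔-sym)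
open import Relation.Binary.PropositionalEquality
  using (refl; sym; trans; cong; cong₂; subst; subst₂; module ≡-Reasoning)

open Equivalence using (to; from)

≤∸[∸]⇔+≤+ : ∀ {a r c n} → r ∸ c ≤ n → a ≤ n → (a ≤ n ∸ (r ∸ c) ⇔ a + r ≤ c + n)
≤∸[∸]⇔+≤+ {a} {r} {c} {n} r∸c≤n a≤n = mk⇔ to′ from′
  where
  to′ : a ≤ n ∸ (r ∸ c) → a + r ≤ c + n
  to′ h = begin
    a + r             ≤⟨ +-monoʳ-≤ a (m≤n+m∸n r c) ⟩
    a + (c + (r ∸ c)) ≡⟨ x∙yz≈y∙xz +-commutativeSemigroup a c (r ∸ c) ⟩
    c + (a + (r ∸ c)) ≤⟨ +-monoʳ-≤ c (m≤o∸n⇒m+n≤o a r∸c≤n h) ⟩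
    c + n             ∎
    where open ≤-Reasoning
  from′ : a + r ≤ c + n → a ≤ n ∸ (r ∸ c)
  from′ h = m+n≤o⇒m≤o∸n a (a+[r∸c]≤n (≤-total c r))
    where
    a+[r∸c]≤n : c ≤ r ⊎ r ≤ c → a + (r ∸ c) ≤ n
    a+[r∸c]≤n (inj₁ c≤r) = subst (_≤ n) (+-∸-assoc a c≤r) (m≤n+o⇒m∸n≤o (a + r) c h)
    a+[r∸c]≤n (inj₂ r≤c) rewrite m≤n⇒m∸n≡0 r≤c | +-identityʳ a = a≤n

toℕ-⇒ₜ : ∀ {n} (a b : 𝒯 n) → toℕ (a ⇒ₜ b) ≡ n ∸ (toℕ a ∸ toℕ b)
toℕ-⇒ₜ a b = Fin.toℕ-fromℕ< _

⇒ₜ-antitoneˡ : ∀ {n} {r r′ : 𝒯 n} (c : 𝒯 n) → r ≤ₜ r′ → r′ ⇒ₜ c ≤ₜ r ⇒ₜ c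
⇒ₜ-antitoneˡ {n} {r} {r′} c r≤r′ rewrite toℕ-⇒ₜ r c | toℕ-⇒ₜ r′ c =
  ∸-monoʳ-≤ n (∸-monoˡ-≤ (toℕ c) r≤r′)

≤⇒ₜ⇔+≤+ : ∀ {n} (a r c : 𝒯 n) → (a ≤ₜ r ⇒ₜ c ⇔ toℕ a + toℕ r ≤ toℕ c + n)
≤⇒ₜ⇔+≤+ a r c rewrite toℕ-⇒ₜ r c =
  ≤∸[∸]⇔+≤+ (≤-trans (m∸n≤m (toℕ r) (toℕ c)) (Fin.toℕ≤pred[n] r)) (Fin.toℕ≤pred[n] a)

⇒ₜ-exchange : ∀ {n} {a r : 𝒯 n} (c : 𝒯 n) → a ≤ₜ r ⇒ₜ c → r ≤ₜ a ⇒ₜ c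
⇒ₜ-exchange {n} {a} {r} c h =
  from (≤⇒ₜ⇔+≤+ r a c) (subst (_≤ toℕ c + n) (+-comm (toℕ a) (toℕ r)) (to (≤⇒ₜ⇔+≤+ a r c) h))

≤-sup⇒ₜ⇔ : ∀ {n} {I : Set} {f : I → 𝒯 n} {s a : 𝒯 n} (c : 𝒯 n) →
           IsSup f s → (a ≤ₜ s ⇒ₜ c ⇔ (∀ i → a ≤ₜ f i ⇒ₜ c))
≤-sup⇒ₜ⇔ {a = a} c (upper , least) = mk⇔
  (λ h i → Fin.≤-trans h (⇒ₜ-antitoneˡ c (upper i)))
  (λ h → ⇒ₜ-exchange c (least (a ⇒ₜ c) (λ i → ⇒ₜ-exchange c (h i))))

module _ {n} {S : Fm → Set} {J : Model n} (closed : SubClosed S) (F : Filtration J S) where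
  open Filtration F
  private
    module V = IsExtension J.isExt
    module V* = IsExtension J*.isExt

  V-resp-q : ∀ {φ x y} → S φ → q x ≡ q y → J.V x φ ≡ J.V y φ
  V-resp-q {φ} {x} {y} s qx≡qy = from (to (q-eq x y) qx≡qy φ s (J.V y φ)) refl

  img-prop≐prop* : ∀ {φ} → (∀ x → J.V x φ ≡ J*.V (q x) φ) → img (prop J.V φ) ≐ prop J*.V φ
  img-prop≐prop* {φ} V≡V*∘q i w = mk⇔
    (λ { (x , refl , Vx≡i) → trans (sym (V≡V*∘q x)) Vx≡i })
    (λ V*w≡i → let (x , qx≡w) = q-surj w in
      x , qx≡w , trans (V≡V*∘q x) (subst (λ v → J*.V v φ ≡ i) (sym qx≡w) V*w≡i))

  ≻-preserved : ∀ {φ ψ} → S (φ ≻ ψ) →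
                (∀ x → J.V x φ ≡ J*.V (q x) φ) → (∀ x → J.V x ψ ≡ J*.V (q x) ψ) →
                ∀ x → J.V x (φ ≻ ψ) ≡ J*.V (q x) (φ ≻ ψ)
  ≻-preserved {φ} {ψ} s ihφ ihψ x = Fin.≤-antisym a≤b b≤a
    where
    X = prop J.V φ
    a = J.V x (φ ≻ ψ)
    b = J*.V (q x) (φ ≻ ψ)

    R*≡R*[X] : ∀ v w → J*.R (prop J*.V φ) v w ≡ J*.R (img X) v w
    R*≡R*[X] = J*.R-ext (λ i w → ⇔-sym (img-prop≐prop* ihφ i w))

    R*-sup : ∀ y → IsSup (λ ((x′ , _) , (y′ , _)) → J.R X x′ y′) (J*.R (img X) (q x) (q y))
    R*-sup = cond-b X (V.presup φ) x

    b≤a : b ≤ₜ a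
    b≤a = proj₂ (V.V-≻ x φ ψ) b λ y →
      to (≤-sup⇒ₜ⇔ (J.V y ψ) (R*-sup y))
         (subst₂ (λ r c → b ≤ₜ r ⇒ₜ c) (R*≡R*[X] (q x) (q y)) (sym (ihψ y))
                 (proj₁ (V*.V-≻ (q x) φ ψ) (q y)))
         ((x , refl) , (y , refl))

    a≤R*⇒ : ∀ y → a ≤ₜ J*.R (prop J*.V φ) (q x) (q y) ⇒ₜ J*.V (q y) ψ
    a≤R*⇒ y = subst₂ (λ r c → a ≤ₜ r ⇒ₜ c) (sym (R*≡R*[X] (q x) (q y))) (ihψ y)
      (from (≤-sup⇒ₜ⇔ (J.V y ψ) (R*-sup y)) λ ((x′ , x′~x) , (y′ , y′~y)) →
        subst₂ (λ a′ c → a′ ≤ₜ J.R X x′ y′ ⇒ₜ c)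
               (V-resp-q s x′~x) (V-resp-q (closed (sub-≻ʳ φ ψ) s) y′~y)
               (proj₁ (V.V-≻ x′ φ ψ) y′))

    a≤b : a ≤ₜ b
    a≤b = proj₂ (V*.V-≻ (q x) φ ψ) a λ w → a≤R*⇒-class w (q-surj w)
      where
      a≤R*⇒-class : ∀ w → ∃ (λ y → q y ≡ w) → a ≤ₜ J*.R (prop J*.V φ) (q x) w ⇒ₜ J*.V w ψ
      a≤R*⇒-class _ (y , refl) = a≤R*⇒ y

  V≡V*∘q : ∀ φ → S φ → ∀ x → J.V x φ ≡ J*.V (q x) φ
  V≡V*∘q (var p) s x = begin
    J.V x (var p)      ≡⟨ V.V-var x p ⟩
    J.ν p x            ≡⟨ sym (cond-a p s x) ⟩
    J*.ν p (q x)       ≡⟨ sym (V*.V-var (q x) p) ⟩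
    J*.V (q x) (var p) ∎
    where open ≡-Reasoning
  V≡V*∘q (¬' φ) s x = begin
    J.V x (¬' φ)       ≡⟨ V.V-¬ x φ ⟩
    ∼ J.V x φ          ≡⟨ cong ∼_ (V≡V*∘q φ (closed (sub-¬ φ) s) x) ⟩
    ∼ J*.V (q x) φ     ≡⟨ sym (V*.V-¬ (q x) φ) ⟩
    J*.V (q x) (¬' φ)  ∎
    where open ≡-Reasoning
  V≡V*∘q (φ ⟶ ψ) s x = begin
    J.V x (φ ⟶ ψ)                    ≡⟨ V.V-⟶ x φ ψ ⟩
    J.V x φ ⇒ₜ J.V x ψ               ≡⟨ cong₂ _⇒ₜ_ (V≡V*∘q φ (closed (sub-⟶ˡ φ ψ) s) x)
                                                    (V≡V*∘q ψ (closed (sub-⟶ʳ φ ψ) s) x) ⟩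
    J*.V (q x) φ ⇒ₜ J*.V (q x) ψ     ≡⟨ sym (V*.V-⟶ (q x) φ ψ) ⟩
    J*.V (q x) (φ ⟶ ψ)               ∎
    where open ≡-Reasoning
  V≡V*∘q (φ ≻ ψ) s =
    ≻-preserved s (V≡V*∘q φ (closed (sub-≻ˡ φ ψ) s)) (V≡V*∘q ψ (closed (sub-≻ʳ φ ψ) s))

theorem3p2 : (n : ℕ) → 1 ≤ n → (S : Fm → Set) → SubClosed S →
    (J : Model n) → (F : Filtration J S) →
    ∀ φ → S φ →
      ((∀ x a → (Model.V J x φ ≡ a ⇔ Model.V (Filtration.J* F) (Filtration.q F x) φ ≡ a))
       × (Filtration.img F (prop (Model.V J) φ) ≐ prop (Model.V (Filtration.J* F)) φ))
theorem3p2 n _ S closed J F φ s =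
  (λ x a → mk⇔ (trans (sym (preserved x))) (trans (preserved x))) , img-prop≐prop* closed F preserved
  where
  preserved : ∀ x → Model.V J x φ ≡ Model.V (Filtration.J* F) (Filtration.q F x) φ
  preserved = V≡V*∘q closed F φ s
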